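{- Suppose that $G$ is a graph admitting a tree-decomposition into finite cliques (every part induces a finite complete subgraph of $G$). Then $G$ is chordal, has a normal spanning tree, and does not contain $\mathcal H$ as an induced minor.
   Context: A graph is chordal if it has no induced cycle of length at least four. A normal spanning tree of a connected graph is a rooted spanning tree such that the endpoints of every edge of the graph are comparable in the tree-order. $\mathcal H$ denotes the graph obtained from an infinite clique by adding two non-adjacent vertices each adjacent to all vertices of the clique. $H$ is an induced minor of $G$ if there are disjoint connected subgraphs $B_v\subseteq G$ ($v\in V(H)$) such that for distinct $u,v$ there is a $B_u$–$B_v$ edge in $G$ precisely when $uv\in E(H)$. -}

module Defs where

open import Data.Nat using (ℕ; zero; suc; _≤_; _∸_)
open import Data.Fin using (Fin; toℕ)
open import Data.List using (List; []; _∷_)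
open import Data.List.Membership.Propositional using (_∈_)
open import Data.List.Relation.Unary.All using (All)
open import Data.List.Relation.Unary.Unique.Propositional using (Unique)
open import Data.Product using (Σ; Σ-syntax; ∃; ∃-syntax; _×_; _,_)
open import Data.Sum using (_⊎_; inj₁; inj₂)
open import Data.Bool using (Bool; true; false)
open import Data.Unit using (⊤)
open import Data.Empty using (⊥)
open import Function.Definitions using (Injective)
open import Relation.Nullary using (¬_)
open import Relation.Binary.PropositionalEquality using (_≡_)

record Graph : Set₁ where
  field
    V      : Set
    E      : V → V → Set
    E-sym  : ∀ {x y} → E x y → E y x
    E-irr  : ∀ {x} → ¬ E x x

data Walk {V : Set} (R : V → V → Set) : V → V → List V → Set where
  stop : ∀ x → Walk R x x (x ∷ [])
  step : ∀ {x y z xs} → R x y → Walk R y z xs → Walk R x z (x ∷ xs)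

Path : {V : Set} → (V → V → Set) → V → V → List V → Set
Path R x y xs = Walk R x y xs × Unique xs

ConnectedOn : {V : Set} → (V → V → Set) → (V → Set) → Set
ConnectedOn R P = ∀ x y → P x → P y → Σ[ xs ∈ _ ] (Walk R x y xs × All P xs)

Connected : {V : Set} → (V → V → Set) → Set
Connected {V} R = V × (∀ (x y : V) → ∃[ xs ] Walk R x y xs)

Next : (n : ℕ) → Fin n → Fin n → Set
Next n i j = (toℕ j ≡ suc (toℕ i)) ⊎ ((toℕ i ≡ n ∸ 1) × (toℕ j ≡ 0))

Acyclic : {V : Set} → (V → V → Set) → Set
Acyclic {V} R = ∀ (n : ℕ) (c : Fin n → V) → 3 ≤ n → Injective _≡_ _≡_ c →
  ¬ (∀ i j → Next n i j → R (c i) (c j))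

IsTree : {V : Set} → (V → V → Set) → Set
IsTree R = Connected R × Acyclic R

-- G has no induced cycle of length at least 4
Chordal : Graph → Set
Chordal G = ∀ (n : ℕ) (c : Fin n → V) → 4 ≤ n → Injective _≡_ _≡_ c →
  ¬ (∀ i j → (E (c i) (c j) → Next n i j ⊎ Next n j i)
           × (Next n i j ⊎ Next n j i → E (c i) (c j)))
  where open Graph G

record TreeDecomposition (G : Graph) : Set₁ where
  open Graph G
  field
    T         : Graph
    T-tree    : IsTree (Graph.E T)
    part      : Graph.V T → V → Set
    cover     : ∀ v → ∃[ t ] part t v
    edgeCover : ∀ u v → E u v → ∃[ t ] (part t u × part t v)
    coherent  : ∀ v → ConnectedOn (Graph.E T) (λ t → part t v)

FiniteSet : {V : Set} → (V → Set) → Set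
FiniteSet {V} P = Σ[ xs ∈ List V ] (∀ v → P v → v ∈ xs)

IsClique : (G : Graph) → (Graph.V G → Set) → Set
IsClique G P = ∀ u v → P u → P v → ¬ u ≡ v → Graph.E G u v

FiniteCliqueParts : {G : Graph} → TreeDecomposition G → Set
FiniteCliqueParts {G} D = ∀ t → FiniteSet (part t) × IsClique G (part t)
  where open TreeDecomposition D

TreeLeq : {V : Set} → (V → V → Set) → V → V → V → Set
TreeLeq F r x y = Σ[ xs ∈ _ ] (Path F r y xs × x ∈ xs)

record NormalSpanningTree (G : Graph) : Set₁ where
  open Graph G
  field
    F      : V → V → Set
    F-sub  : ∀ {x y} → F x y → E x y
    F-sym  : ∀ {x y} → F x y → F y x
    F-tree : IsTree F
    root   : V
    normal : ∀ x y → E x y → TreeLeq F root x y ⊎ TreeLeq F root y x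

InducedMinor : Graph → Graph → Set₁
InducedMinor H G =
  Σ[ B ∈ (Graph.V H → Graph.V G → Set) ]
    ( (∀ h → ∃[ v ] B h v)
    × (∀ h → ConnectedOn (Graph.E G) (B h))
    × (∀ h h' v → B h v → B h' v → h ≡ h')
    × (∀ h h' → ¬ h ≡ h' →
         ((Σ[ x ∈ Graph.V G ] Σ[ y ∈ Graph.V G ] (B h x × B h' y × Graph.E G x y)) → Graph.E H h h')
       × (Graph.E H h h' → Σ[ x ∈ Graph.V G ] Σ[ y ∈ Graph.V G ] (B h x × B h' y × Graph.E G x y))))

-- 𝓗: a countably infinite clique (vertices inj₁ n) plus two non-adjacent
-- vertices (inj₂ true, inj₂ false) adjacent to every clique vertex.
ℋE : ℕ ⊎ Bool → ℕ ⊎ Bool → Set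
ℋE (inj₁ m) (inj₁ n) = ¬ m ≡ n
ℋE (inj₁ _) (inj₂ _) = ⊤
ℋE (inj₂ _) (inj₁ _) = ⊤
ℋE (inj₂ _) (inj₂ _) = ⊥

ℋE-sym : ∀ {x y} → ℋE x y → ℋE y x
ℋE-sym {inj₁ m} {inj₁ n} p q = p (Relation.Binary.PropositionalEquality.sym q)
ℋE-sym {inj₁ _} {inj₂ _} _ = Data.Unit.tt
ℋE-sym {inj₂ _} {inj₁ _} _ = Data.Unit.tt

ℋE-irr : ∀ {x} → ¬ ℋE x x
ℋE-irr {inj₁ m} p = p Relation.Binary.PropositionalEquality.refl

ℋ : Graph
ℋ = record { V = ℕ ⊎ Bool ; E = ℋE ; E-sym = ℋE-sym ; E-irr = ℋE-irr }

{-# OPTIONS --safe #-}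
module Submission where

-- Root the decomposition tree and let top v be the highest part containing v. Numbering the vertices
-- part by part from the root downwards yields a key such that every earlier neighbour of v lies in
-- top v, because the parts containing a vertex form a subtree. So the earlier neighbourhoods are
-- finite cliques: the key is a perfect elimination order, and everything follows from that.
-- The latest vertex of an induced cycle has adjacent cycle neighbours, giving a chord. Joining every
-- vertex to its latest earlier neighbour gives a forest whose tree-order contains every edge.
-- In an induced ℋ-minor the tree-least vertices of the infinitely many clique branch sets are
-- distinct, while only finitely many vertices lie above any vertex; so one of them, t, lies above
-- neither of two chosen vertices of the independent branch sets. Each of these connected sets sees
-- the branch set below t, hence contains an earlier neighbour of t, and these two are adjacent.

open import Defs
open import Level using (0ℓ)
open import Axiom.ExcludedMiddle using (ExcludedMiddle)
open import Axiom.DoubleNegationElimination using (em⇒dne)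
open import Data.Nat using (ℕ; zero; suc; _+_; _∸_; _≤_; _<_; _≤?_; _≟_; z≤n; s≤s)
open import Data.Nat.Properties
open import Data.Nat.Induction using (<-rec; <-wellFounded)
open import Data.Fin using (Fin; toℕ; fromℕ; inject₁; lower₁) renaming (zero to fzero; suc to fsuc)
open import Data.Fin.Properties
  using (toℕ-injective; toℕ<n; toℕ≤pred[n]; toℕ-fromℕ; toℕ-inject₁; toℕ-lower₁; pigeonhole)
open import Data.List using (List; []; _∷_; _++_; [_]; filter; allFin; length; lookup)
open import Data.List.Membership.Propositional using (_∈_)
open import Data.List.Membership.Propositional.Properties using (∈-filter⁺; ∈-allFin; ∈-++⁺ˡ; ∈-++⁺ʳ; ∈-++⁻)
open import Data.List.Relation.Unary.All as All using (All; []; _∷_)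
open import Data.List.Relation.Unary.All.Properties using (all-filter)
open import Data.List.Relation.Unary.Any using (here; there; index)
open import Data.List.Relation.Unary.Any.Properties using (lookup-index)
import Data.List.Relation.Unary.AllPairs as AllPairs
open import Data.List.Relation.Unary.Unique.Propositional.Properties using (++⁺)
open import Data.List.Extrema.Nat using (argmax; argmax-all; f[xs]≤f[argmax])
open import Data.Product using (Σ; Σ-syntax; ∃; ∃-syntax; _×_; _,_; proj₁; proj₂)
open import Data.Sum using (_⊎_; inj₁; inj₂; swap; map; map₁)
open import Data.Sum.Properties using (inj₁-injective)
open import Data.Bool using (Bool; true; false)
open import Data.Empty using (⊥; ⊥-elim)
open import Data.Unit using (⊤; tt)
open import Function using (_∘_; case_of_)
open import Function.Definitions using (Injective)
import Induction.WellFounded as WF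
import Relation.Binary.Construct.On as On
open import Relation.Nullary using (¬_; yes; no)
open import Relation.Unary using (Decidable)
open import Relation.Binary.Definitions using (tri<; tri≈; tri>)
open import Relation.Binary.PropositionalEquality
  using (_≡_; _≢_; refl; sym; trans; cong; subst; subst₂; module ≡-Reasoning)

module Classical (lem : ExcludedMiddle 0ℓ) where

  opaque
    least : (P : ℕ → Set) → ∀ n → P n → Σ[ m ∈ ℕ ] P m × (∀ k → P k → m ≤ k)
    least P = <-rec (λ n → P n → Σ[ m ∈ ℕ ] P m × (∀ k → P k → m ≤ k)) descend
      where
      descend : ∀ n → (∀ {k} → k < n → P k → Σ[ m ∈ ℕ ] P m × (∀ k → P k → m ≤ k)) →
             P n → Σ[ m ∈ ℕ ] P m × (∀ k → P k → m ≤ k)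
      descend n below pn with lem {Σ[ k ∈ ℕ ] k < n × P k}
      ... | yes (k , k<n , pk) = below k<n pk
      ... | no ∄k = n , pn , λ k pk → ≮⇒≥ (λ k<n → ∄k (k , k<n , pk))

    minimal : {A : Set} {P : A → Set} (μ : A → ℕ) → Σ A P →
              Σ[ m ∈ A ] P m × (∀ x → P x → μ m ≤ μ x)
    minimal {A} {P} μ (x , px) with least (λ k → Σ[ y ∈ A ] P y × μ y ≡ k) (μ x) (x , px , refl)
    ... | _ , (m , pm , refl) , min = m , pm , λ y py → min (μ y) (y , py , refl)

    maximal : {A : Set} {P : A → Set} (μ : A → ℕ) → FiniteSet P → Σ A P →
              Σ[ m ∈ A ] P m × (∀ x → P x → μ x ≤ μ m)
    maximal {P = P} μ (xs , complete) (x , px) =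
      argmax μ x (filter P? xs) , argmax-all μ px (all-filter P? xs) , below
      where
      P? : Decidable P
      P? y = lem {P y}
      below : ∀ y → P y → μ y ≤ μ (argmax μ x (filter P? xs))
      below y py = All.lookup (f[xs]≤f[argmax] {f = μ} x (filter P? xs)) (∈-filter⁺ P? (complete y py) py)

  minimum : {A : Set} (μ : A → ℕ) → A → Σ[ m ∈ A ] (∀ x → μ m ≤ μ x)
  minimum μ x = let m , _ , below = minimal {P = λ _ → ⊤} μ (x , tt) in m , λ y → below y tt

  ¬¬-elim : {P : Set} → ¬ ¬ P → P
  ¬¬-elim = em⇒dne lem

  ¬∀⇒∃¬ : {A : Set} {P : A → Set} → ¬ (∀ x → P x) → ∃[ x ] ¬ P x
  ¬∀⇒∃¬ ¬∀ = ¬¬-elim λ ∄ → ¬∀ λ x → ¬¬-elim λ ¬px → ∄ (x , ¬px)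

max-index : ∀ {n} (μ : Fin (suc n) → ℕ) → Σ[ i ∈ Fin (suc n) ] (∀ j → μ j ≤ μ i)
max-index μ = argmax μ fzero (allFin _) ,
              λ j → All.lookup (f[xs]≤f[argmax] {f = μ} fzero (allFin _)) (∈-allFin j)

∈-index-injective : {A : Set} {x y : A} {xs : List A} (p : x ∈ xs) (q : y ∈ xs) →
                    toℕ (index p) ≡ toℕ (index q) → x ≡ y
∈-index-injective {xs = xs} p q eq = begin
  _                       ≡⟨ lookup-index p ⟩
  lookup xs (index p)     ≡⟨ cong (lookup xs) (toℕ-injective eq) ⟩
  lookup xs (index q)     ≡⟨ sym (lookup-index q) ⟩
  _                       ∎
  where open ≡-Reasoning

injective-image-not-finite : {A : Set} {P : A → Set} (f : ℕ → A) → Injective _≡_ _≡_ f →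
                       FiniteSet P → ¬ (∀ n → P (f n))
injective-image-not-finite f f-inj (xs , complete) all-in =
  let i , j , i<j , same-slot = pigeonhole (n<1+n (length xs)) slot
  in <-irrefl (f-inj (∈-index-injective (member i) (member j) (cong toℕ same-slot))) i<j
  where
  member : ∀ k → f (toℕ k) ∈ xs
  member k = complete _ (all-in (toℕ k))
  slot : Fin (suc (length xs)) → Fin (length xs)
  slot k = index (member k)

FiniteSet-⊎ : {A : Set} {P Q : A → Set} → FiniteSet P → FiniteSet Q → FiniteSet (λ x → P x ⊎ Q x)
FiniteSet-⊎ (xs , P⊆xs) (ys , Q⊆ys) =
  xs ++ ys , λ { x (inj₁ px) → ∈-++⁺ˡ (P⊆xs x px) ; x (inj₂ qx) → ∈-++⁺ʳ xs (Q⊆ys x qx) }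

-- `Next (suc m) i j` unfolds to `CyclicSucc m (toℕ i) (toℕ j)`.
CyclicSucc : ℕ → ℕ → ℕ → Set
CyclicSucc m x y = (y ≡ suc x) ⊎ (x ≡ m × y ≡ 0)

cyclicSucc-functional : ∀ {m x y y'} → y ≤ m → y' ≤ m →
                        CyclicSucc m x y → CyclicSucc m x y' → y ≡ y'
cyclicSucc-functional _   _    (inj₁ refl)         (inj₁ refl)         = refl
cyclicSucc-functional y≤m _    (inj₁ refl)         (inj₂ (refl , _))   = ⊥-elim (1+n≰n y≤m)
cyclicSucc-functional _   y'≤m (inj₂ (refl , _))   (inj₁ refl)         = ⊥-elim (1+n≰n y'≤m)
cyclicSucc-functional _   _    (inj₂ (_ , refl))   (inj₂ (_ , refl))   = refl

cyclicSucc-irrefl : ∀ {m x} → ¬ CyclicSucc (suc m) x x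
cyclicSucc-irrefl (inj₁ ())
cyclicSucc-irrefl (inj₂ (refl , ()))

no-2-cycle : ∀ {m x y} → CyclicSucc (suc (suc m)) x y → ¬ CyclicSucc (suc (suc m)) y x
no-2-cycle (inj₁ refl) (inj₁ ())
no-2-cycle (inj₁ refl) (inj₂ (() , refl))
no-2-cycle (inj₂ (refl , refl)) (inj₁ ())
no-2-cycle (inj₂ (refl , refl)) (inj₂ (() , _))

no-3-cycle : ∀ {m x y z} → CyclicSucc (3 + m) x y → CyclicSucc (3 + m) y z → ¬ CyclicSucc (3 + m) z x
no-3-cycle (inj₁ refl) (inj₁ refl) (inj₁ ())
no-3-cycle (inj₁ refl) (inj₁ refl) (inj₂ (refl , ()))
no-3-cycle (inj₁ refl) (inj₂ (refl , refl)) (inj₁ ())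
no-3-cycle (inj₁ refl) (inj₂ (refl , refl)) (inj₂ (() , _))
no-3-cycle (inj₂ (refl , refl)) (inj₁ refl) (inj₁ ())
no-3-cycle (inj₂ (refl , refl)) (inj₁ refl) (inj₂ (() , _))
no-3-cycle (inj₂ (refl , refl)) (inj₂ (() , _)) _

cyclic-succ : ∀ {m} → Fin (suc m) → Fin (suc m)
cyclic-succ {m} i with m ≟ toℕ i
... | yes _   = fzero
... | no m≢i = fsuc (lower₁ i m≢i)

next-cyclic-succ : ∀ {m} (i : Fin (suc m)) → Next (suc m) i (cyclic-succ i)
next-cyclic-succ {m} i with m ≟ toℕ i
... | yes m≡i = inj₂ (sym m≡i , refl)
... | no m≢i  = inj₁ (cong suc (toℕ-lower₁ i m≢i))

cyclic-pred : ∀ {m} → Fin (suc m) → Fin (suc m)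
cyclic-pred {m} fzero = fromℕ m
cyclic-pred (fsuc i)  = inject₁ i

next-cyclic-pred : ∀ {m} (i : Fin (suc m)) → Next (suc m) (cyclic-pred i) i
next-cyclic-pred {m} fzero = inj₂ (toℕ-fromℕ m , refl)
next-cyclic-pred (fsuc i)  = inj₁ (cong suc (sym (toℕ-inject₁ i)))

neighbours-distinct : ∀ {m} {h i j : Fin (3 + m)} → Next _ h i → Next _ i j → h ≢ j
neighbours-distinct hi ij refl = no-2-cycle hi ij

neighbours-non-adjacent : ∀ {m} {h i j : Fin (4 + m)} → Next _ h i → Next _ i j →
                          ¬ (Next _ h j ⊎ Next _ j h)
neighbours-non-adjacent {i = i} {j} hi ij (inj₁ hj) =
  cyclicSucc-irrefl (subst (λ k → CyclicSucc _ k (toℕ j))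
    (cyclicSucc-functional (toℕ≤pred[n] i) (toℕ≤pred[n] j) hi hj) ij)
neighbours-non-adjacent hi ij (inj₂ jh) = no-3-cycle hi ij jh

module _ {V : Set} {R : V → V → Set} (acyclic : Acyclic R) where

  no-closed-walk : ∀ n (c : ℕ → V) → 2 ≤ n →
                   (∀ {x y} → x ≤ n → y ≤ n → c x ≡ c y → x ≡ y) →
                   (∀ x → x < n → R (c x) (c (suc x))) → R (c n) (c 0) → ⊥
  no-closed-walk n c 2≤n c-inj edge close =
    acyclic (suc n) (c ∘ toℕ) (s≤s 2≤n)
      (λ e → toℕ-injective (c-inj (toℕ≤pred[n] _) (toℕ≤pred[n] _) e)) next-edge
    where
    next-edge : ∀ i j → Next (suc n) i j → R (c (toℕ i)) (c (toℕ j))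
    next-edge i j (inj₁ j≡1+i) =
      subst (R _ ∘ c) (sym j≡1+i) (edge (toℕ i) (subst (_≤ n) j≡1+i (toℕ≤pred[n] j)))
    next-edge i j (inj₂ (i≡n , j≡0)) = subst₂ (λ x y → R (c x) (c y)) (sym i≡n) (sym j≡0) close

  module _ (a b : ℕ → V) (p q : ℕ) where

    private
      n = p + q

      -- the closed walk a₀ … a_p = b_q … b₀ a₀
      c : ℕ → V
      c x with x ≤? p
      ... | yes _ = a x
      ... | no _  = b (n ∸ x)

      c-low : ∀ {x} → x ≤ p → c x ≡ a x
      c-low {x} x≤p with x ≤? p
      ... | yes _   = refl
      ... | no x≰p = ⊥-elim (x≰p x≤p)

      c-high : ∀ {x} → p < x → c x ≡ b (n ∸ x)
      c-high {x} p<x with x ≤? p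
      ... | yes x≤p = ⊥-elim (<⇒≱ p<x x≤p)
      ... | no _    = refl

      n∸x<q : ∀ {x} → p < x → x ≤ n → n ∸ x < q
      n∸x<q {x} p<x x≤n = subst (n ∸ x <_) (m+n∸m≡n p q) (∸-monoʳ-< p<x x≤n)

    no-two-chain-cycle : 1 ≤ p → 1 ≤ q → a p ≡ b q →
      (∀ i → i < p → R (a i) (a (suc i))) → (∀ j → j < q → R (b (suc j)) (b j)) →
      R (b 0) (a 0) →
      (∀ {i i'} → i ≤ p → i' ≤ p → a i ≡ a i' → i ≡ i') →
      (∀ {j j'} → j < q → j' < q → b j ≡ b j' → j ≡ j') →
      (∀ {i j} → i ≤ p → j < q → a i ≢ b j) → ⊥
    no-two-chain-cycle 1≤p 1≤q meet a-edge b-edge close a-inj b-inj ab-disjoint =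
      no-closed-walk n c (+-mono-≤ 1≤p 1≤q) c-inj c-edge c-close
      where
      c-inj : ∀ {x y} → x ≤ n → y ≤ n → c x ≡ c y → x ≡ y
      c-inj {x} {y} x≤n y≤n e with ≤-<-connex x p | ≤-<-connex y p
      ... | inj₁ x≤p | inj₁ y≤p = a-inj x≤p y≤p (trans (sym (c-low x≤p)) (trans e (c-low y≤p)))
      ... | inj₁ x≤p | inj₂ p<y =
        ⊥-elim (ab-disjoint x≤p (n∸x<q p<y y≤n) (trans (sym (c-low x≤p)) (trans e (c-high p<y))))
      ... | inj₂ p<x | inj₁ y≤p =
        ⊥-elim (ab-disjoint y≤p (n∸x<q p<x x≤n) (trans (sym (c-low y≤p)) (trans (sym e) (c-high p<x))))
      ... | inj₂ p<x | inj₂ p<y = ∸-cancelˡ-≡ x≤n y≤n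
        (b-inj (n∸x<q p<x x≤n) (n∸x<q p<y y≤n) (trans (sym (c-high p<x)) (trans e (c-high p<y))))

      c-b : ∀ {x} → p ≤ x → c x ≡ b (n ∸ x)
      c-b {x} p≤x with m≤n⇒m<n∨m≡n p≤x
      ... | inj₁ p<x  = c-high p<x
      ... | inj₂ refl = trans (c-low ≤-refl) (trans meet (cong b (sym (m+n∸m≡n p q))))

      c-edge : ∀ x → x < n → R (c x) (c (suc x))
      c-edge x x<n with ≤-<-connex p x
      ... | inj₂ x<p = subst₂ R (sym (c-low (<⇒≤ x<p))) (sym (c-low x<p)) (a-edge x x<p)
      ... | inj₁ p≤x = subst₂ R (sym (trans (c-b p≤x) (cong b (+-∸-assoc 1 x<n)))) (sym (c-b (m≤n⇒m≤1+n p≤x)))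
        (b-edge (n ∸ suc x) (n∸x<q (s≤s p≤x) x<n))

      c-close : R (c n) (c 0)
      c-close = subst₂ R (sym (trans (c-b (m≤m+n p q)) (cong b (n∸n≡0 n)))) (sym (c-low z≤n)) close

module _ {V : Set} {R : V → V → Set} where

  walk-length : ∀ {x y xs} → Walk R x y xs → ℕ
  walk-length (stop _)   = 0
  walk-length (step _ w) = suc (walk-length w)

  All-first : ∀ {P : V → Set} {x y xs} → Walk R x y xs → All P xs → P x
  All-first (stop _)   (px ∷ _) = px
  All-first (step _ _) (px ∷ _) = px

  second : ∀ {x y xs} → Walk R x y xs → V
  second (stop x)            = x
  second (step {y = s} _ _) = s

  second-spec : ∀ {x y xs} (w : Walk R x y xs) →
                (second w ≡ x × x ≡ y × walk-length w ≡ 0)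
                ⊎ (R x (second w) × Σ[ w′ ∈ ∃ (Walk R (second w) y) ] walk-length w ≡ suc (walk-length (proj₂ w′)))
  second-spec (stop _)      = inj₁ (refl , refl , refl)
  second-spec (step e rest) = inj₂ (e , (_ , rest) , refl)

  _◅◅_ : ∀ {x y z xs ys} → Walk R x y xs → Walk R y z ys → ∃ (Walk R x z)
  stop _   ◅◅ w' = _ , w'
  step e w ◅◅ w' = _ , step e (proj₂ (w ◅◅ w'))

  snoc : ∀ {x y z xs} → Walk R x y xs → R y z → Walk R x z (xs ++ [ z ])
  snoc (stop _)    e = step e (stop _)
  snoc (step e' w) e = step e' (snoc w e)

  reverse : (∀ {x y} → R x y → R y x) → ∀ {x y xs} → Walk R x y xs → ∃ (Walk R y x)
  reverse R-sym (stop x)   = _ , stop x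
  reverse R-sym (step e w) = _ , snoc (proj₂ (reverse R-sym w)) (R-sym e)

iterate : {A : Set} → (A → A) → ℕ → A → A
iterate f zero    x = x
iterate f (suc k) x = iterate f k (f x)

module Forest {A : Set} (f : A → A) where

  iterate-+ : ∀ m n x → iterate f (m + n) x ≡ iterate f n (iterate f m x)
  iterate-+ zero    n x = refl
  iterate-+ (suc m) n x = iterate-+ m n (f x)

  iterate-suc : ∀ k x → iterate f (suc k) x ≡ f (iterate f k x)
  iterate-suc zero    x = refl
  iterate-suc (suc k) x = iterate-suc k (f x)

  iterate-fixed : ∀ {x} → f x ≡ x → ∀ k → iterate f k x ≡ x
  iterate-fixed fx≡x zero    = refl
  iterate-fixed fx≡x (suc k) rewrite fx≡x = iterate-fixed fx≡x k

  infix 4 _≼_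
  _≼_ : A → A → Set
  x ≼ y = ∃[ k ] iterate f k y ≡ x

  ≼-refl : ∀ {x} → x ≼ x
  ≼-refl = 0 , refl

  ≼-trans : ∀ {x y z} → x ≼ y → y ≼ z → x ≼ z
  ≼-trans {z = z} (i , p) (j , q) = j + i , trans (iterate-+ j i z) (trans (cong (iterate f i) q) p)

  ≼-parent : ∀ {x y} → x ≼ f y → x ≼ y
  ≼-parent (k , p) = suc k , p

  iterate-≼ : ∀ {i j} z → i ≤ j → iterate f j z ≼ iterate f i z
  iterate-≼ {i} {j} z i≤j = j ∸ i , (begin
    iterate f (j ∸ i) (iterate f i z)   ≡⟨ sym (iterate-+ i (j ∸ i) z) ⟩
    iterate f (i + (j ∸ i)) z           ≡⟨ cong (λ k → iterate f k z) (m+[n∸m]≡n i≤j) ⟩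
    iterate f j z                       ∎)
    where open ≡-Reasoning

  ≼-comparable : ∀ {x y z} → x ≼ z → y ≼ z → x ≼ y ⊎ y ≼ x
  ≼-comparable {z = z} (i , refl) (j , refl) with ≤-total i j
  ... | inj₁ i≤j = inj₂ (iterate-≼ z i≤j)
  ... | inj₂ j≤i = inj₁ (iterate-≼ z j≤i)

  ≼-fixed : ∀ {x r} → f r ≡ r → x ≼ r → x ≡ r
  ≼-fixed fr≡r (k , p) = trans (sym p) (iterate-fixed fr≡r k)

  module _ {R : A → A → Set} (comparable : ∀ {x y} → R x y → x ≼ y ⊎ y ≼ x) where

    ≼-along-walk : ∀ {X : A → Set} {m u z xs} → (∀ {w} → X w → w ≼ m → w ≡ m) →
                   Walk R u z xs → All X xs → m ≼ u → m ≼ z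
    ≼-along-walk minimal (stop _) _ m≼u = m≼u
    ≼-along-walk {m = m} minimal (step {y = w} e rest) (_ ∷ Xs) m≼u =
      ≼-along-walk minimal rest Xs (m≼w (comparable e))
      where
      m≼w : _ ≼ w ⊎ w ≼ _ → m ≼ w
      m≼w (inj₁ u≼w) = ≼-trans m≼u u≼w
      m≼w (inj₂ w≼u) with ≼-comparable m≼u w≼u
      ... | inj₁ m≼w = m≼w
      ... | inj₂ w≼m = subst (m ≼_) (sym (minimal (All-first rest Xs) w≼m)) ≼-refl

  module _ {R : A → A → Set} (parent-edge : ∀ {x y} → R x y → f x ≡ y ⊎ f y ≡ x) where

    passes-or-stays-below : ∀ {a u z xs} → Walk R u z xs → a ≼ u → a ∈ xs ⊎ a ≼ z
    passes-or-stays-below (stop _)   a≼u          = inj₂ a≼u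
    passes-or-stays-below (step _ _) (zero , refl) = inj₁ (here refl)
    passes-or-stays-below (step e w) (suc k , p) with parent-edge e
    ... | inj₁ refl = map₁ there (passes-or-stays-below w (k , p))
    ... | inj₂ refl = map₁ there (passes-or-stays-below w (suc (suc k) , p))

module Ranked {A : Set} (f : A → A) (rank : A → ℕ)
              (descends : ∀ x → f x ≡ x ⊎ rank (f x) < rank x) where

  open Forest f public

  rank-parent : ∀ x → rank (f x) ≤ rank x
  rank-parent x with descends x
  ... | inj₁ fx≡x = ≤-reflexive (cong rank fx≡x)
  ... | inj₂ lt   = <⇒≤ lt

  moved⇒rank< : ∀ {x} → f x ≢ x → rank (f x) < rank x
  moved⇒rank< {x} fx≢x with descends x
  ... | inj₁ fx≡x = ⊥-elim (fx≢x fx≡x)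
  ... | inj₂ lt   = lt

  ≼-rank : ∀ {x y} → x ≼ y → rank x ≤ rank y
  ≼-rank (zero , refl)  = ≤-refl
  ≼-rank {y = y} (suc k , p) = ≤-trans (≼-rank (k , p)) (rank-parent y)

  ≼⇒≡⊎< : ∀ {x y} → x ≼ y → x ≡ y ⊎ rank x < rank y
  ≼⇒≡⊎< (zero , p) = inj₁ (sym p)
  ≼⇒≡⊎< {y = y} (suc k , p) with descends y
  ... | inj₁ fy≡y = inj₁ (≼-fixed fy≡y (suc k , p))
  ... | inj₂ lt   = inj₂ (≤-<-trans (≼-rank (k , p)) lt)

  ≼-antisym : ∀ {x y} → x ≼ y → y ≼ x → x ≡ y
  ≼-antisym x≼y y≼x with ≼⇒≡⊎< x≼y
  ... | inj₁ x≡y = x≡y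
  ... | inj₂ lt  = ⊥-elim (<⇒≱ lt (≼-rank y≼x))

  module _ {R : A → A → Set} (comparable : ∀ {x y} → R x y → x ≼ y ⊎ y ≼ x) where

    rank-least⇒≼-least : ∀ {X : A → Set} {m} → ConnectedOn R X → X m → (∀ {x} → X x → rank m ≤ rank x) →
                         ∀ {z} → X z → m ≼ z
    rank-least⇒≼-least {X} {m} connected Xm least {z} Xz =
      let _ , walk , inside = connected m z Xm Xz in ≼-along-walk comparable no-smaller walk inside ≼-refl
      where
      no-smaller : ∀ {w} → X w → w ≼ m → w ≡ m
      no-smaller Xw w≼m with ≼⇒≡⊎< w≼m
      ... | inj₁ w≡m = w≡m
      ... | inj₂ w<m = ⊥-elim (<⇒≱ w<m (least Xw))

  ForestEdge : A → A → Set
  ForestEdge x y = (y ≡ f x × y ≢ x) ⊎ (x ≡ f y × x ≢ y)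

  ForestEdge-sym : ∀ {x y} → ForestEdge x y → ForestEdge y x
  ForestEdge-sym = swap

  ForestEdge-up : ∀ {x y} → ForestEdge x y → rank y ≤ rank x → y ≡ f x
  ForestEdge-up (inj₁ (y≡fx , _)) _ = y≡fx
  ForestEdge-up (inj₂ (refl , fy≢y)) fy≤y = ⊥-elim (<⇒≱ (moved⇒rank< fy≢y) fy≤y)

  forest-acyclic : Acyclic ForestEdge
  forest-acyclic (suc (suc (suc m))) c (s≤s (s≤s (s≤s _))) c-inj edge =
    neighbours-distinct hi ij (c-inj (trans h-up (sym j-up)))
    where
    i-max = max-index (rank ∘ c)
    i = proj₁ i-max
    hi = next-cyclic-pred i
    ij = next-cyclic-succ i
    h-up : c (cyclic-pred i) ≡ f (c i)
    h-up = ForestEdge-up (ForestEdge-sym (edge _ i hi)) (proj₂ i-max _)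
    j-up : c (cyclic-succ i) ≡ f (c i)
    j-up = ForestEdge-up (edge i _ ij) (proj₂ i-max _)

  record AncestorPath (y : A) : Set where
    field
      root       : A
      root-fixed : f root ≡ root
      vertices   : List A
      path       : Path ForestEdge root y vertices
      complete   : ∀ {x} → x ≼ y → x ∈ vertices
      sound      : ∀ {x} → x ∈ vertices → x ≼ y

  ancestor-path : ∀ y → AncestorPath y
  ancestor-path = WF.All.wfRec (On.wellFounded rank <-wellFounded) 0ℓ AncestorPath extend
    where
    extend : ∀ y → (∀ {x} → rank x < rank y → AncestorPath x) → AncestorPath y
    extend y below with descends y
    ... | inj₁ fy≡y = record
      { root = y ; root-fixed = fy≡y ; vertices = [ y ]
      ; path = stop y , [] AllPairs.∷ AllPairs.[]
      ; complete = λ x≼y → here (≼-fixed fy≡y x≼y)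
      ; sound = λ { (here refl) → ≼-refl } }
    ... | inj₂ fy<y = record
      { root = root ; root-fixed = root-fixed ; vertices = vertices ++ [ y ]
      ; path = snoc (proj₁ path) (inj₂ (refl , fy≢y))
             , ++⁺ (proj₂ path) ([] AllPairs.∷ AllPairs.[]) y∉vertices
      ; complete = complete′
      ; sound = sound′ }
      where
      open AncestorPath (below fy<y)
      fy≢y : f y ≢ y
      fy≢y fy≡y = <-irrefl (cong rank fy≡y) fy<y
      y∉vertices : ∀ {x} → x ∈ vertices × x ∈ [ y ] → ⊥
      y∉vertices (x∈ , here refl) = <⇒≱ fy<y (≼-rank (sound x∈))
      complete′ : ∀ {x} → x ≼ y → x ∈ vertices ++ [ y ]
      complete′ (zero , refl) = ∈-++⁺ʳ vertices (here refl)
      complete′ (suc k , p)   = ∈-++⁺ˡ (complete (k , p))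
      sound′ : ∀ {x} → x ∈ vertices ++ [ y ] → x ≼ y
      sound′ x∈ with ∈-++⁻ vertices x∈
      ... | inj₁ x∈vs        = ≼-parent (sound x∈vs)
      ... | inj₂ (here refl) = ≼-refl

  ancestors-finite : ∀ y → FiniteSet (_≼ y)
  ancestors-finite y = vertices , λ _ → complete
    where open AncestorPath (ancestor-path y)

Earlier : (G : Graph) → (Graph.V G → ℕ) → Graph.V G → Graph.V G → Set
Earlier G key w v = Graph.E G w v × key w < key v

record PerfectElimination (G : Graph) : Set where
  open Graph G
  field
    key            : V → ℕ
    key-separates  : ∀ {x y} → E x y → key x ≢ key y
    earlier-finite : ∀ v → FiniteSet (λ w → Earlier G key w v)
    earlier-clique : ∀ v → IsClique G (λ w → Earlier G key w v)

module FromPerfectElimination (lem : ExcludedMiddle 0ℓ) {G : Graph} (P : PerfectElimination G) where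
  open Graph G
  open PerfectElimination P
  open Classical lem

  infix 4 _⊏_
  _⊏_ : V → V → Set
  w ⊏ v = Earlier G key w v

  earlier-of-≤ : ∀ {x y} → E x y → key x ≤ key y → x ⊏ y
  earlier-of-≤ e x≤y = e , ≤∧≢⇒< x≤y (key-separates e)

  chordal : Chordal G
  chordal (suc (suc (suc (suc m)))) c (s≤s (s≤s (s≤s (s≤s _)))) c-inj induced =
    neighbours-non-adjacent hi ij (proj₁ (induced h j) h~j)
    where
    i-max = max-index (key ∘ c)
    i = proj₁ i-max
    h = cyclic-pred i
    j = cyclic-succ i
    hi = next-cyclic-pred i
    ij = next-cyclic-succ i
    h⊏i : c h ⊏ c i
    h⊏i = earlier-of-≤ (proj₂ (induced h i) (inj₁ hi)) (proj₂ i-max h)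
    j⊏i : c j ⊏ c i
    j⊏i = earlier-of-≤ (E-sym (proj₂ (induced i j) (inj₁ ij))) (proj₂ i-max j)
    h~j : E (c h) (c j)
    h~j = earlier-clique (c i) (c h) (c j) h⊏i j⊏i (neighbours-distinct hi ij ∘ c-inj)

  parent : V → V
  parent v with lem {∃[ w ] w ⊏ v}
  ... | yes has-earlier = proj₁ (maximal key (earlier-finite v) has-earlier)
  ... | no _            = v

  parent-spec : ∀ v → (¬ (∃[ w ] w ⊏ v) × parent v ≡ v)
                    ⊎ (parent v ⊏ v × (∀ w → w ⊏ v → key w ≤ key (parent v)))
  parent-spec v with lem {∃[ w ] w ⊏ v}
  ... | yes has-earlier = inj₂ (proj₂ (maximal key (earlier-finite v) has-earlier))
  ... | no none         = inj₁ (none , refl)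

  parent-⊏ : ∀ {w v} → w ⊏ v → parent v ⊏ v
  parent-⊏ {w} {v} w⊏v with parent-spec v
  ... | inj₁ (none , _)     = ⊥-elim (none (w , w⊏v))
  ... | inj₂ (p⊏v , _)      = p⊏v

  parent-maximal : ∀ {w v} → w ⊏ v → key w ≤ key (parent v)
  parent-maximal {w} {v} w⊏v with parent-spec v
  ... | inj₁ (none , _)     = ⊥-elim (none (w , w⊏v))
  ... | inj₂ (_ , maximum)  = maximum w w⊏v

  parent-descends : ∀ v → parent v ≡ v ⊎ key (parent v) < key v
  parent-descends v with parent-spec v
  ... | inj₁ (_ , p≡v)     = inj₁ p≡v
  ... | inj₂ ((_ , p<v) , _) = inj₂ p<v

  parent-adjacent : ∀ {v} → parent v ≢ v → E (parent v) v
  parent-adjacent {v} p≢v with parent-spec v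
  ... | inj₁ (_ , p≡v)      = ⊥-elim (p≢v p≡v)
  ... | inj₂ ((p~v , _) , _) = p~v

  open Ranked parent key parent-descends

  -- x and parent u are both earlier neighbours of u, hence adjacent
  earlier-climb : ∀ {x u} → x ⊏ u → key x < key (parent u) → x ⊏ parent u
  earlier-climb {x} {u} x⊏u x<p =
    earlier-clique u x (parent u) x⊏u (parent-⊏ x⊏u) (λ x≡p → <-irrefl (cong key x≡p) x<p) , x<p

  ⊏⇒≼ : ∀ {x y} → x ⊏ y → x ≼ y
  ⊏⇒≼ {x} {y} = WF.All.wfRec (On.wellFounded key <-wellFounded) 0ℓ (λ y → x ⊏ y → x ≼ y) ascend y
    where
    ascend : ∀ y → (∀ {u} → key u < key y → x ⊏ u → x ≼ u) → x ⊏ y → x ≼ y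
    ascend y below x⊏y with lem {x ≡ parent y}
    ... | yes x≡p = 1 , sym x≡p
    ... | no x≢p  = ≼-parent (below (proj₂ (parent-⊏ x⊏y)) (earlier-climb x⊏y x<p))
      where
      x<p : key x < key (parent y)
      x<p = ≤∧≢⇒< (parent-maximal x⊏y)
              (key-separates (earlier-clique y x (parent y) x⊏y (parent-⊏ x⊏y) x≢p))

  normal : ∀ {x y} → E x y → x ≼ y ⊎ y ≼ x
  normal {x} {y} e with ≤-total (key x) (key y)
  ... | inj₁ x≤y = inj₁ (⊏⇒≼ (earlier-of-≤ e x≤y))
  ... | inj₂ y≤x = inj₂ (⊏⇒≼ (earlier-of-≤ (E-sym e) y≤x))

  earlier-of-ancestor : ∀ {x u t} → E x u → t ≼ u → key x < key t → x ⊏ t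
  earlier-of-ancestor {x} e (k , refl) x<t = climb k (e , <-≤-trans x<t (≼-rank (k , refl))) x<t
    where
    climb : ∀ k {u} → x ⊏ u → key x < key (iterate parent k u) → x ⊏ iterate parent k u
    climb zero    x⊏u _   = x⊏u
    climb (suc k) x⊏u x<t = climb k (earlier-climb x⊏u (<-≤-trans x<t (≼-rank (k , refl)))) x<t

  earlier-of-outside-neighbour : ∀ {x u t} → E x u → t ≼ u → ¬ t ≼ x → x ⊏ t
  earlier-of-outside-neighbour e t≼u t⋠x with normal e
  ... | inj₂ u≼x = ⊥-elim (t⋠x (≼-trans t≼u u≼x))
  ... | inj₁ x≼u with ≼-comparable t≼u x≼u
  ...   | inj₁ t≼x = ⊥-elim (t⋠x t≼x)
  ...   | inj₂ x≼t with ≼⇒≡⊎< x≼t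
  ...     | inj₁ refl = ⊥-elim (t⋠x ≼-refl)
  ...     | inj₂ x<t  = earlier-of-ancestor e t≼u x<t

  least-of-connected : ∀ {X : V → Set} → ∃ X → ConnectedOn E X → Σ[ m ∈ V ] X m × (∀ {z} → X z → m ≼ z)
  least-of-connected nonempty connected =
    let m , Xm , least = minimal key nonempty in
    m , Xm , rank-least⇒≼-least normal connected Xm (least _)

  ForestEdge⊆E : ∀ {x y} → ForestEdge x y → E x y
  ForestEdge⊆E (inj₁ (refl , p≢x)) = E-sym (parent-adjacent p≢x)
  ForestEdge⊆E (inj₂ (refl , p≢y)) = parent-adjacent p≢y

  normal-spanning-tree : Connected E → NormalSpanningTree G
  normal-spanning-tree (v₀ , walks) = record
    { F      = ForestEdge
    ; F-sub  = ForestEdge⊆E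
    ; F-sym  = ForestEdge-sym
    ; F-tree = (v₀ , λ x y → proj₂ (reverse ForestEdge-sym (path-to x)) ◅◅ path-to y) , forest-acyclic
    ; root   = r
    ; normal = λ x y e → map (tree-order x y) (tree-order y x) (normal e)
    }
    where
    connected : ConnectedOn E (λ _ → ⊤)
    connected x y _ _ = let xs , w = walks x y in xs , w , All.universal (λ _ → tt) xs
    everything = least-of-connected (v₀ , tt) connected
    r = proj₁ everything
    r≼ : ∀ z → r ≼ z
    r≼ z = proj₂ (proj₂ everything) tt
    unique-root : ∀ {r'} → parent r' ≡ r' → r' ≡ r
    unique-root fr'≡r' = sym (≼-fixed fr'≡r' (r≼ _))
    rooted-path : ∀ y → Σ[ xs ∈ List V ] (Path ForestEdge r y xs × (∀ {x} → x ≼ y → x ∈ xs))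
    rooted-path y = vertices , subst (λ s → Path ForestEdge s y vertices) (unique-root root-fixed) path , complete
      where open AncestorPath (ancestor-path y)
    path-to : ∀ y → Walk ForestEdge r y (proj₁ (rooted-path y))
    path-to y = proj₁ (proj₁ (proj₂ (rooted-path y)))
    tree-order : ∀ x y → x ≼ y → TreeLeq ForestEdge r x y
    tree-order x y x≼y = let xs , path , complete = rooted-path y in xs , path , complete x≼y

  exit-earlier : ∀ {X : V → Set} {t u z xs} → Walk E u z xs → All X xs → t ≼ u → ¬ t ≼ z →
                 Σ[ x ∈ V ] X x × x ⊏ t
  exit-earlier (stop _) _ t≼u t⋠z = ⊥-elim (t⋠z t≼u)
  exit-earlier {t = t} (step {y = w} e rest) (_ ∷ Xs) t≼u t⋠z with lem {t ≼ w}
  ... | yes t≼w = exit-earlier rest Xs t≼w t⋠z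
  ... | no t⋠w  = w , All-first rest Xs , earlier-of-outside-neighbour (E-sym e) t≼u t⋠w

  earlier-in-neighbouring-set : ∀ {X : V → Set} {t a x u} → ConnectedOn E X → X a → ¬ t ≼ a →
                                X x → E x u → t ≼ u → Σ[ x′ ∈ V ] X x′ × x′ ⊏ t
  earlier-in-neighbouring-set {t = t} {a} {x} connected Xa t⋠a Xx x~u t≼u with lem {t ≼ x}
  ... | no t⋠x  = x , Xx , earlier-of-outside-neighbour x~u t≼u t⋠x
  ... | yes t≼x with connected x a Xx Xa
  ...   | _ , walk , inside = exit-earlier walk inside t≼x t⋠a

  no-ℋ-minor : ¬ InducedMinor ℋ G
  no-ℋ-minor (B , nonempty , connected , disjoint , adjacency) =
    let x , Bx , x⊏t = attach true (proj₂ free ∘ inj₁)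
        y , By , y⊏t = attach false (proj₂ free ∘ inj₂)
    in proj₁ (adjacency (inj₂ true) (inj₂ false) (λ ()))
             (x , y , Bx , By , earlier-clique t x y x⊏t y⊏t (distinct Bx By))
    where
    top : ℕ → V
    top n = proj₁ (least-of-connected (nonempty (inj₁ n)) (connected (inj₁ n)))
    top∈B : ∀ n → B (inj₁ n) (top n)
    top∈B n = proj₁ (proj₂ (least-of-connected (nonempty (inj₁ n)) (connected (inj₁ n))))
    top≼ : ∀ n {z} → B (inj₁ n) z → top n ≼ z
    top≼ n = proj₂ (proj₂ (least-of-connected (nonempty (inj₁ n)) (connected (inj₁ n))))
    top-injective : Injective _≡_ _≡_ top
    top-injective {n} {n'} eq =
      inj₁-injective (disjoint _ _ _ (top∈B n) (subst (B (inj₁ n')) (sym eq) (top∈B n')))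

    anchor : Bool → V
    anchor h = proj₁ (nonempty (inj₂ h))

    free : ∃[ n ] ¬ (top n ≼ anchor true ⊎ top n ≼ anchor false)
    free = ¬∀⇒∃¬ (injective-image-not-finite top top-injective
             (FiniteSet-⊎ (ancestors-finite (anchor true)) (ancestors-finite (anchor false))))
    t = top (proj₁ free)

    attach : ∀ h → ¬ t ≼ anchor h → Σ[ x ∈ V ] B (inj₂ h) x × x ⊏ t
    attach h t⋠anchor =
      let x , u , Bx , Bu , x~u = proj₂ (adjacency (inj₂ h) (inj₁ (proj₁ free)) (λ ())) tt
      in earlier-in-neighbouring-set (connected (inj₂ h)) (proj₂ (nonempty (inj₂ h))) t⋠anchor Bx x~u (top≼ _ Bu)

    distinct : ∀ {x y} → B (inj₂ true) x → B (inj₂ false) y → x ≢ y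
    distinct Bx By refl with disjoint _ _ _ Bx By
    ... | ()

module RootedTree (lem : ExcludedMiddle 0ℓ) (T : Graph) (T-tree : IsTree (Graph.E T)) where
  open Graph T
  open Classical lem

  root : V
  root = proj₁ (proj₁ T-tree)

  WalkToRoot : V → Set
  WalkToRoot t = Σ (List V) (Walk E t root)

  opaque
    geodesic : ∀ t → Σ[ w ∈ WalkToRoot t ] (∀ (w′ : WalkToRoot t) → walk-length (proj₂ w) ≤ walk-length (proj₂ w′))
    geodesic t = minimum (walk-length ∘ proj₂) (proj₂ (proj₁ T-tree) t root)

  depth : V → ℕ
  depth t = walk-length (proj₂ (proj₁ (geodesic t)))

  parent : V → V
  parent t = second (proj₂ (proj₁ (geodesic t)))

  depth-step : ∀ {s t} → E s t → depth s ≤ suc (depth t)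
  depth-step {s} {t} e = proj₂ (geodesic s) (_ , step e (proj₂ (proj₁ (geodesic t))))

  parent-cases : ∀ t → (parent t ≡ t × t ≡ root × depth t ≡ 0)
                     ⊎ (E t (parent t) × depth t ≡ suc (depth (parent t)))
  parent-cases t = case second-spec (proj₂ (proj₁ (geodesic t))) of λ where
    (inj₁ at-root)             → inj₁ at-root
    (inj₂ (e , rest , len≡)) → inj₂ (e , ≤-antisym (depth-step e)
      (≤-trans (s≤s (proj₂ (geodesic (parent t)) rest)) (≤-reflexive (sym len≡))))

  parent-descends : ∀ t → parent t ≡ t ⊎ depth (parent t) < depth t
  parent-descends t with parent-cases t
  ... | inj₁ (p≡t , _)  = inj₁ p≡t
  ... | inj₂ (_ , d≡1+) = inj₂ (≤-reflexive (sym d≡1+))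

  open Ranked parent depth parent-descends public

  depth-iterate : ∀ k t → k ≤ depth t → depth (iterate parent k t) ≡ depth t ∸ k
  depth-iterate zero    t _   = refl
  depth-iterate (suc k) t k<d with parent-cases t
  ... | inj₁ (_ , _ , d≡0) = ⊥-elim (<⇒≱ k<d (subst (_≤ k) (sym d≡0) z≤n))
  ... | inj₂ (_ , d≡1+)    = trans (depth-iterate k (parent t) (≤-pred (subst (suc k ≤_) d≡1+ k<d)))
                                   (cong (_∸ suc k) (sym d≡1+))

  depth≡0⇒root : ∀ {t} → depth t ≡ 0 → t ≡ root
  depth≡0⇒root {t} d≡0 with parent-cases t
  ... | inj₁ (_ , t≡root , _) = t≡root
  ... | inj₂ (_ , d≡1+)       = ⊥-elim (1+n≢0 (trans (sym d≡1+) d≡0))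

  reaches-root : ∀ t → iterate parent (depth t) t ≡ root
  reaches-root t = depth≡0⇒root (trans (depth-iterate (depth t) t ≤-refl) (n∸n≡0 (depth t)))

  chain-edge : ∀ {i t} → i < depth t → E (iterate parent i t) (iterate parent (suc i) t)
  chain-edge {i} {t} i<d with parent-cases (iterate parent i t)
  ... | inj₁ (_ , _ , d≡0) = ⊥-elim (<-irrefl (sym (trans (sym (depth-iterate i t (<⇒≤ i<d))) d≡0))
                                               (m<n⇒0<n∸m i<d))
  ... | inj₂ (e , _)       = subst (E _) (sym (iterate-suc i t)) e

  chain-injective : ∀ {i j t} → i ≤ depth t → j ≤ depth t →
                    iterate parent i t ≡ iterate parent j t → i ≡ j
  chain-injective {i} {j} {t} i≤d j≤d eq =
    ∸-cancelˡ-≡ i≤d j≤d (trans (sym (depth-iterate i t i≤d)) (trans (cong depth eq) (depth-iterate j t j≤d)))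

  chains-meet : ∀ d {s t} → depth t ≡ d + depth s →
                iterate parent (depth s) s ≡ iterate parent (d + depth s) t
  chains-meet d {s} {t} t-deeper =
    trans (reaches-root s) (sym (trans (cong (λ k → iterate parent k t) (sym t-deeper)) (reaches-root t)))

  meeting-offset : ∀ d {s t i j} → depth t ≡ d + depth s → i ≤ depth s → j ≤ depth t →
                   iterate parent i s ≡ iterate parent j t → j ≡ d + i
  meeting-offset d {s} {t} {i} {j} t-deeper i≤ds j≤dt meet =
    ∸-cancelˡ-≡ j≤dt (subst (d + i ≤_) (sym t-deeper) (+-monoʳ-≤ d i≤ds)) (begin
      depth t ∸ j                     ≡⟨ sym (depth-iterate j t j≤dt) ⟩
      depth (iterate parent j t)      ≡⟨ cong depth (sym meet) ⟩
      depth (iterate parent i s)      ≡⟨ depth-iterate i s i≤ds ⟩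
      depth s ∸ i                     ≡⟨ sym ([m+n]∸[m+o]≡n∸o d (depth s) i) ⟩
      (d + depth s) ∸ (d + i)         ≡⟨ cong (_∸ (d + i)) (sym t-deeper) ⟩
      depth t ∸ (d + i)               ∎)
    where open ≡-Reasoning

  -- The ancestor chains of s and t, cut at their first meeting point, close up with st into a cycle.
  no-offset-edge : ∀ d {s t} → E s t → depth t ≡ d + depth s → iterate parent d t ≢ s → ⊥
  no-offset-edge d {s} {t} e t-deeper not-parent
    with least (λ k → iterate parent k s ≡ iterate parent (d + k) t) (depth s) (chains-meet d {s} {t} t-deeper)
  ... | zero , meets , _ =
    not-parent (sym (trans meets (cong (λ k → iterate parent k t) (+-identityʳ d))))
  ... | suc k , meets , first =
    no-two-chain-cycle (proj₂ T-tree) a b (suc k) (d + suc k) (s≤s z≤n) (m≤n⇒m≤o+n d (s≤s z≤n))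
      meets a-edge b-edge (E-sym e) a-injective b-injective disjoint
    where
    a b : ℕ → V
    a i = iterate parent i s
    b j = iterate parent j t
    k<ds : suc k ≤ depth s
    k<ds = first (depth s) (chains-meet d {s} {t} t-deeper)
    dk≤dt : d + suc k ≤ depth t
    dk≤dt = subst (d + suc k ≤_) (sym t-deeper) (+-monoʳ-≤ d k<ds)
    a-edge : ∀ i → i < suc k → E (a i) (a (suc i))
    a-edge i i<k = chain-edge (<-≤-trans i<k k<ds)
    b-edge : ∀ j → j < d + suc k → E (b (suc j)) (b j)
    b-edge j j<q = E-sym (chain-edge (<-≤-trans j<q dk≤dt))
    a-injective : ∀ {i i'} → i ≤ suc k → i' ≤ suc k → a i ≡ a i' → i ≡ i'
    a-injective i≤k i'≤k = chain-injective (≤-trans i≤k k<ds) (≤-trans i'≤k k<ds)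
    b-injective : ∀ {j j'} → j < d + suc k → j' < d + suc k → b j ≡ b j' → j ≡ j'
    b-injective j<q j'<q = chain-injective (≤-trans (<⇒≤ j<q) dk≤dt) (≤-trans (<⇒≤ j'<q) dk≤dt)
    disjoint : ∀ {i j} → i ≤ suc k → j < d + suc k → a i ≢ b j
    disjoint {i} {j} i≤k j<q ai≡bj =
      let j≡d+i = meeting-offset d t-deeper (≤-trans i≤k k<ds) (≤-trans (<⇒≤ j<q) dk≤dt) ai≡bj in
      <⇒≱ (+-cancelˡ-< d i (suc k) (subst (_< d + suc k) j≡d+i j<q))
          (first i (subst (a i ≡_) (cong (λ m → iterate parent m t) j≡d+i) ai≡bj))

  parent-of-deeper : ∀ {s t} → E s t → depth s < depth t → parent t ≡ s
  parent-of-deeper e s<t = ¬¬-elim (no-offset-edge 1 e (≤-antisym (depth-step (E-sym e)) s<t))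

  parent-edge : ∀ {s t} → E s t → parent s ≡ t ⊎ parent t ≡ s
  parent-edge {s} {t} e with <-cmp (depth s) (depth t)
  ... | tri< s<t _ _  = inj₂ (parent-of-deeper e s<t)
  ... | tri> _ _ t<s  = inj₁ (parent-of-deeper (E-sym e) t<s)
  ... | tri≈ _ same _ = ⊥-elim (no-offset-edge 0 e (sym same) (λ t≡s → E-irr (subst (E s) t≡s e)))

module Decomposition (lem : ExcludedMiddle 0ℓ) {G : Graph} (D : TreeDecomposition G)
                     (finite-cliques : FiniteCliqueParts D) where
  open Graph G
  open TreeDecomposition D
  open Graph T using () renaming (V to Node; E to Eᵀ)
  open RootedTree lem T T-tree
  open Classical lem

  tree-normal : ∀ {s t} → Eᵀ s t → s ≼ t ⊎ t ≼ s
  tree-normal e with parent-edge e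
  ... | inj₁ ps≡t = inj₂ (1 , ps≡t)
  ... | inj₂ pt≡s = inj₁ (1 , pt≡s)

  highest : ∀ v → Σ[ t ∈ Node ] part t v × (∀ s → part s v → depth t ≤ depth s)
  highest v = minimal depth (cover v)

  top : V → Node
  top v = proj₁ (highest v)

  top-part : ∀ v → part (top v) v
  top-part v = proj₁ (proj₂ (highest v))

  top-≼ : ∀ {v s} → part s v → top v ≼ s
  top-≼ {v} = rank-least⇒≼-least tree-normal (coherent v) (top-part v) (proj₂ (proj₂ (highest v)) _)

  part-convex : ∀ {v s a} → part s v → a ≼ s → top v ≼ a → part a v
  part-convex {v} {s} {a} ps a≼s top≼a
    with coherent v s (top v) ps (top-part v)
  ... | _ , walk , inside with passes-or-stays-below parent-edge walk a≼s
  ...   | inj₁ a∈walk = All.lookup inside a∈walk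
  ...   | inj₂ a≼top  = subst (λ t → part t v) (≼-antisym top≼a a≼top) (top-part v)

  members : Node → List V
  members t = proj₁ (proj₁ (finite-cliques t))

  member : ∀ {t v} → part t v → v ∈ members t
  member {t} {v} = proj₂ (proj₁ (finite-cliques t)) v

  size : Node → ℕ
  size t = length (members t)

  height : Node → ℕ
  height t = go (depth t) t
    where
    go : ℕ → Node → ℕ
    go zero    t = 0
    go (suc k) t = size (parent t) + go k (parent t)

  height-parent : ∀ {t} → parent t ≢ t → height t ≡ size (parent t) + height (parent t)
  height-parent {t} p≢t with parent-cases t
  ... | inj₁ (p≡t , _) = ⊥-elim (p≢t p≡t)
  ... | inj₂ (_ , d≡1+) rewrite d≡1+ = refl

  height-strict : ∀ {a t} → a ≼ t → a ≢ t → height a + size a ≤ height t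
  height-strict {a} (k , p) = go k p
    where
    go : ∀ k {t} → iterate parent k t ≡ a → a ≢ t → height a + size a ≤ height t
    go zero    refl a≢t = ⊥-elim (a≢t refl)
    go (suc k) {t} p a≢t with lem {parent t ≡ t} | lem {a ≡ parent t}
    ... | yes p≡t | _       = ⊥-elim (a≢t (≼-fixed p≡t (suc k , p)))
    ... | no p≢t  | yes a≡p = begin
      height a + size a                   ≡⟨ cong (λ x → height x + size x) a≡p ⟩
      height (parent t) + size (parent t) ≡⟨ +-comm (height (parent t)) (size (parent t)) ⟩
      size (parent t) + height (parent t) ≡⟨ sym (height-parent p≢t) ⟩
      height t                            ∎
      where open ≤-Reasoning
    ... | no p≢t  | no a≢p  = begin
      height a + size a                   ≤⟨ go k p a≢p ⟩
      height (parent t)                   ≤⟨ m≤n+m _ (size (parent t)) ⟩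
      size (parent t) + height (parent t) ≡⟨ sym (height-parent p≢t) ⟩
      height t                            ∎
      where open ≤-Reasoning

  slot : V → ℕ
  slot v = toℕ (index (member (top-part v)))

  key : V → ℕ
  key v = height (top v) + slot v

  key-strict : ∀ {x y} → top x ≼ top y → depth (top x) < depth (top y) → key x < key y
  key-strict {x} {y} above deeper = begin-strict
    height (top x) + slot x         <⟨ +-monoʳ-< (height (top x)) (toℕ<n (index (member (top-part x)))) ⟩
    height (top x) + size (top x)   ≤⟨ height-strict above (λ same → <-irrefl (cong depth same) deeper) ⟩
    height (top y)                  ≤⟨ m≤m+n (height (top y)) (slot y) ⟩
    key y                           ∎
    where open ≤-Reasoning

  key-same-top : ∀ {x y} → top x ≡ top y → key x ≡ key y → x ≡ y
  key-same-top {x} {y} same = injective same (member (top-part x)) (member (top-part y))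
    where
    injective : ∀ {t t'} → t ≡ t' → (px : x ∈ members t) (py : y ∈ members t') →
                height t + toℕ (index px) ≡ height t' + toℕ (index py) → x ≡ y
    injective {t} refl px py eq = ∈-index-injective px py (+-cancelˡ-≡ (height t) _ _ eq)

  top-≼-of-key≤ : ∀ {s x y} → part s x → part s y → key x ≤ key y → top x ≼ top y
  top-≼-of-key≤ {s} {x} {y} px py x≤y with ≼-comparable (top-≼ px) (top-≼ py)
  ... | inj₁ above = above
  ... | inj₂ below with ≼⇒≡⊎< below
  ...   | inj₁ same   = subst (top x ≼_) (sym same) ≼-refl
  ...   | inj₂ deeper = ⊥-elim (<⇒≱ (key-strict below deeper) x≤y)

  earlier-in-top : ∀ {w v} → E w v → key w < key v → part (top v) w
  earlier-in-top {w} {v} e w<v =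
    let s , pw , pv = edgeCover w v e
    in part-convex pw (top-≼ pv) (top-≼-of-key≤ pw pv (<⇒≤ w<v))

  key-injective : ∀ {s x y} → part s x → part s y → key x ≡ key y → x ≡ y
  key-injective px py same-key with top-≼-of-key≤ px py (≤-reflexive same-key)
  ... | above with ≼⇒≡⊎< above
  ...   | inj₁ same-top = key-same-top same-top same-key
  ...   | inj₂ deeper   = ⊥-elim (<-irrefl same-key (key-strict above deeper))

  key-separates : ∀ {x y} → E x y → key x ≢ key y
  key-separates {x} {y} e same-key =
    let _ , px , py = edgeCover x y e in E-irr (subst (E x) (sym (key-injective px py same-key)) e)

  perfect-elimination : PerfectElimination G
  perfect-elimination = record
    { key            = key
    ; key-separates  = key-separates
    ; earlier-finite = λ v → members (top v) , λ w (w~v , w<v) → member (earlier-in-top w~v w<v)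
    ; earlier-clique = λ v x y (x~v , x<v) (y~v , y<v) →
        proj₂ (finite-cliques (top v)) x y (earlier-in-top x~v x<v) (earlier-in-top y~v y<v)
    }

lemma3p2 : ExcludedMiddle 0ℓ → (G : Graph) → (D : TreeDecomposition G) → FiniteCliqueParts D →
    Chordal G × (Connected (Graph.E G) → NormalSpanningTree G) × ¬ InducedMinor ℋ G
lemma3p2 lem G D finite-cliques = chordal , normal-spanning-tree , no-ℋ-minor
  where open FromPerfectElimination lem (Decomposition.perfect-elimination lem D finite-cliques)
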